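{- Let $n \in \mathbb{N}$ with $n \geq 2$ and let $\mathcal{F} \subseteq \mathcal{P}([n])$ be a nontrivial, union closed family with $m = \#\mathcal{F}$ satisfying $m \geq \frac{7n}{\log_2 n}$. Then there is an $x \in [n]$ with $$\#\{F \in \mathcal{F} : x \in F\} \geq \frac{\sqrt{\log_2 n}}{3n} \cdot \#\mathcal{F}.$$
   Context: $[n] = \{1,\dots,n\}$, $\mathcal{P}([n])$ its power set, $\#X$ the cardinality. $\mathcal{F}$ is nontrivial if $\bigcup_{F \in \mathcal{F}} F = [n]$ and union closed if $A, B \in \mathcal{F}$ implies $A \cup B \in \mathcal{F}$. -}

module Defs where

open import Data.Nat using (ℕ)
open import Data.Fin using (Fin)
open import Data.Fin.Subset using (Subset; _∪_; _∈_)
open import Data.Fin.Subset.Properties using (_∈?_)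
open import Data.List using (List; length; filter)
open import Data.List.Relation.Unary.Unique.Propositional using (Unique)
open import Data.Product using (∃; _×_)
import Data.List.Membership.Propositional as LM

record Family (n : ℕ) : Set where
  constructor family
  field
    members : List (Subset n)
    distinct : Unique members
open Family public

card : ∀ {n} → Family n → ℕ
card F = length (members F)

UnionClosed : ∀ {n} → Family n → Set
UnionClosed F = ∀ A B → A LM.∈ members F → B LM.∈ members F → (A ∪ B) LM.∈ members F

Nontrivial : ∀ {n} → Family n → Set
Nontrivial {n} F = ∀ (x : Fin n) → ∃ λ A → A LM.∈ members F × x ∈ A

freq : ∀ {n} → Family n → Fin n → ℕ
freq F x = length (filter (x ∈?_) (members F))

{-# OPTIONS --safe #-}
module Submission where

-- Let a be a member of least positive size and f the largest frequency of an element. Double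
-- counting gives Σ_{B ∈ F} |a ∩ B| = Σ_{x ∈ a} freq x ≤ |a| f, and B ↦ B ∪ a injects the members
-- disjoint from a into the members containing any fixed x ∈ a, so m ≤ |a| f + f. Likewise
-- Σ_{B ∈ F} |B| ≤ n f, while every member except possibly ∅ has size at least |a|, so
-- (m - 1) |a| ≤ n f. Together m² ≤ f (m |a| + m) ≤ 4 n f²: some element lies in at least
-- m / 2√n members.

open import Defs
open import Data.Nat using (ℕ; zero; suc; _≤_; _<_; _*_; _^_; _+_; z≤n; s≤s; _≟_; NonZero; >-nonZero)
open import Data.Nat.Properties
open import Data.Nat.ListAction using (sum)
open import Algebra.Properties.CommutativeSemigroup +-commutativeSemigroup using (x∙yz≈y∙xz; interchange)
open import Data.Nat.Tactic.RingSolver using (solve-∀)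
open import Data.Fin using (Fin; zero; suc)
open import Data.Fin.Subset using (Subset; inside; outside; _∩_; _∪_; ⊤; ⊥; ∣_∣; _⊆_; Nonempty; Empty)
  renaming (_∈_ to _∈ₛ_)
open import Data.Fin.Subset.Properties
  using (_∈?_; ∣⁅x⁆∣≡1; p⊆q⇒∣p∣≤∣q∣; x∈⁅y⁆⇒x≡y; Empty-unique; nonempty?; ∣⊥∣≡0; ∣⊤∣≡n; ∣p∣≤n;
         ∩-identityˡ; x∈p∩q⁺; x∈p∪q⁻; x∈p∪q⁺; p⊆p∪q; ⊆-antisym)
open import Data.Bool using (true; false)
open import Data.Vec using ([]; _∷_)
open import Data.List using (List; []; _∷_; [_]; _++_; length; filter; map; allFin)
open import Data.List.Properties using (filter-++; length-++; filter-accept; filter-reject; length-removeAt′; map-cong)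
open import Data.List.Membership.Propositional using (_∈_; _─_)
open import Data.List.Membership.Propositional.Properties using (∈-filter⁺; ∈-filter⁻; ∈-allFin)
open import Data.List.Relation.Unary.All as All using (All; []; _∷_)
open import Data.List.Relation.Unary.Any using (here; there; index)
open import Data.List.Relation.Unary.AllPairs using (_∷_)
open import Data.List.Relation.Unary.Unique.Propositional using (Unique)
import Data.List.Relation.Unary.Unique.Propositional.Properties as Unique
open import Data.List.Extrema.Nat using (argmin; argmax; argmin-all; f[argmin]≤f[xs]; f[xs]≤f[argmax])
open import Data.Product using (∃; _×_; _,_; proj₁; proj₂)
open import Data.Sum using (inj₁; inj₂)
open import Function using (_∘_)
open import Relation.Nullary using (Dec; yes; no; does; ¬?; contradiction)
open import Relation.Binary.PropositionalEquality using (_≡_; _≢_; refl; sym; trans; cong; cong₂; subst; subst₂; module ≡-Reasoning)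

∈-─⁺ : ∀ {a} {A : Set a} {x y : A} {ys : List A} (x∈ys : x ∈ ys) → y ∈ ys → y ≢ x → y ∈ ys ─ x∈ys
∈-─⁺ (here refl) (here refl)  y≢x = contradiction refl y≢x
∈-─⁺ (here refl) (there y∈ys) _   = y∈ys
∈-─⁺ (there _)   (here y≡z)   _   = here y≡z
∈-─⁺ (there x∈ys) (there y∈ys) y≢x = there (∈-─⁺ x∈ys y∈ys y≢x)

injection⇒length≤ : ∀ {a b} {A : Set a} {B : Set b} {xs : List A} {ys : List B} (g : A → B) →
  Unique xs → (∀ {x} → x ∈ xs → g x ∈ ys) →
  (∀ {x y} → x ∈ xs → y ∈ xs → g x ≡ g y → x ≡ y) →
  length xs ≤ length ys
injection⇒length≤ {xs = []} g _ _ _ = z≤n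
injection⇒length≤ {xs = x ∷ xs} {ys} g (x∉xs ∷ unique) maps inj = begin
  suc (length xs)            ≤⟨ s≤s (injection⇒length≤ g unique maps′ (λ p q → inj (there p) (there q))) ⟩
  suc (length (ys ─ gx∈ys))  ≡⟨ length-removeAt′ ys (index gx∈ys) ⟨
  length ys                  ∎
  where
  open ≤-Reasoning
  gx∈ys : g x ∈ ys
  gx∈ys = maps (here refl)
  maps′ : ∀ {y} → y ∈ xs → g y ∈ ys ─ gx∈ys
  maps′ y∈xs = ∈-─⁺ gx∈ys (maps (there y∈xs))
    (λ gy≡gx → All.lookup x∉xs y∈xs (sym (inj (there y∈xs) (here refl) gy≡gx)))

module _ {a} {A : Set a} (w : A → ℕ) where

  zeros : List A → List A
  zeros = filter (λ x → w x ≟ 0)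

  ∈-zeros⁻ : ∀ xs {x} → x ∈ zeros xs → x ∈ xs × w x ≡ 0
  ∈-zeros⁻ xs = ∈-filter⁻ (λ x → w x ≟ 0) {xs = xs}

  length*≤sum+zeros : ∀ {k xs} → All (λ x → w x ≢ 0 → k ≤ w x) xs →
    length xs * k ≤ sum (map w xs) + length (zeros xs) * k
  length*≤sum+zeros [] = z≤n
  length*≤sum+zeros {k} {x ∷ xs} (bound ∷ bounds) with w x ≟ 0
  ... | yes wx≡0 = begin
    k + length xs * k                                  ≤⟨ +-monoʳ-≤ k (length*≤sum+zeros bounds) ⟩
    k + (sum (map w xs) + length (zeros xs) * k)       ≡⟨ x∙yz≈y∙xz k (sum (map w xs)) _ ⟩
    sum (map w xs) + (k + length (zeros xs) * k)       ≡⟨ cong₂ (λ wx z → wx + sum (map w xs) + length z * k)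
                                                            (sym wx≡0) (sym (filter-accept (λ x → w x ≟ 0) wx≡0)) ⟩
    w x + sum (map w xs) + length (zeros (x ∷ xs)) * k ∎
    where open ≤-Reasoning
  ... | no wx≢0 = begin
    k + length xs * k                                  ≤⟨ +-mono-≤ (bound wx≢0) (length*≤sum+zeros bounds) ⟩
    w x + (sum (map w xs) + length (zeros xs) * k)     ≡⟨ +-assoc (w x) _ _ ⟨
    w x + sum (map w xs) + length (zeros xs) * k       ≡⟨ cong (λ z → w x + sum (map w xs) + length z * k)
                                                            (filter-reject (λ x → w x ≟ 0) wx≢0) ⟨
    w x + sum (map w xs) + length (zeros (x ∷ xs)) * k ∎
    where open ≤-Reasoning

  length≤sum+zeros : ∀ xs → length xs ≤ sum (map w xs) + length (zeros xs)
  length≤sum+zeros xs = subst₂ _≤_ (*-identityʳ (length xs)) (cong (sum (map w xs) +_) (*-identityʳ _))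
    (length*≤sum+zeros (All.universal (λ _ → n≢0⇒n>0) xs))

  ∃-minimal-positive : ∀ {xs x₀} → x₀ ∈ xs → w x₀ ≢ 0 →
    ∃ λ x → x ∈ xs × w x ≢ 0 × (∀ {y} → y ∈ xs → w y ≢ 0 → w x ≤ w y)
  ∃-minimal-positive {xs} {x₀} x₀∈xs wx₀≢0 =
    let x∈xs , wx≢0 = argmin-all w (x₀∈xs , wx₀≢0) (All.tabulate (∈-filter⁻ positive? {xs = xs}))
    in argmin w x₀ (filter positive? xs) , x∈xs , wx≢0 , λ y∈xs wy≢0 →
         All.lookup (f[argmin]≤f[xs] x₀ (filter positive? xs)) (∈-filter⁺ positive? y∈xs wy≢0)
    where
    positive? : ∀ x → Dec (w x ≢ 0)
    positive? x = ¬? (w x ≟ 0)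

x∈p⇒0<∣p∣ : ∀ {n} {x : Fin n} {p : Subset n} → x ∈ₛ p → 0 < ∣ p ∣
x∈p⇒0<∣p∣ {x = x} {p} x∈p = subst (_≤ ∣ p ∣) (∣⁅x⁆∣≡1 x)
  (p⊆q⇒∣p∣≤∣q∣ (λ y∈⁅x⁆ → subst (_∈ₛ p) (sym (x∈⁅y⁆⇒x≡y x y∈⁅x⁆)) x∈p))

∣p∣≡0⇒Empty : ∀ {n} {p : Subset n} → ∣ p ∣ ≡ 0 → Empty p
∣p∣≡0⇒Empty ∣p∣≡0 (_ , x∈p) = <-irrefl (sym ∣p∣≡0) (x∈p⇒0<∣p∣ x∈p)

∣p∣≢0⇒Nonempty : ∀ {n} {p : Subset n} → ∣ p ∣ ≢ 0 → Nonempty p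
∣p∣≢0⇒Nonempty {n} {p} ∣p∣≢0 with nonempty? p
... | yes nonempty = nonempty
... | no empty     = contradiction (trans (cong ∣_∣ (Empty-unique empty)) (∣⊥∣≡0 n)) ∣p∣≢0

∪-cancelʳ-disjoint : ∀ {n} {p q r : Subset n} → Empty (r ∩ p) → Empty (r ∩ q) → p ∪ r ≡ q ∪ r → p ≡ q
∪-cancelʳ-disjoint {r = r} r∩p≡∅ r∩q≡∅ p∪r≡q∪r =
  ⊆-antisym (⊆-cancel r∩p≡∅ p∪r≡q∪r) (⊆-cancel r∩q≡∅ (sym p∪r≡q∪r))
  where
  ⊆-cancel : ∀ {s t} → Empty (r ∩ s) → s ∪ r ≡ t ∪ r → s ⊆ t
  ⊆-cancel {s} {t} r∩s≡∅ s∪r≡t∪r x∈s with x∈p∪q⁻ t r (subst (_ ∈ₛ_) s∪r≡t∪r (p⊆p∪q r x∈s))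
  ... | inj₁ x∈t = x∈t
  ... | inj₂ x∈r = contradiction (_ , x∈p∩q⁺ (x∈r , x∈s)) r∩s≡∅

sumOver : ∀ {n} → Subset n → (Fin n → ℕ) → ℕ
sumOver []            g = 0
sumOver (inside ∷ p)  g = g zero + sumOver p (g ∘ suc)
sumOver (outside ∷ p) g = sumOver p (g ∘ suc)

syntax sumOver p (λ x → e) = ∑[ x ∈ p ] e

sumOver-cong : ∀ {n} (p : Subset n) {g h : Fin n → ℕ} → (∀ x → g x ≡ h x) → ∑[ x ∈ p ] g x ≡ ∑[ x ∈ p ] h x
sumOver-cong []            g≗h = refl
sumOver-cong (inside ∷ p)  g≗h = cong₂ _+_ (g≗h zero) (sumOver-cong p (g≗h ∘ suc))
sumOver-cong (outside ∷ p) g≗h = sumOver-cong p (g≗h ∘ suc)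

sumOver-zero : ∀ {n} (p : Subset n) → ∑[ x ∈ p ] 0 ≡ 0
sumOver-zero []            = refl
sumOver-zero (inside ∷ p)  = sumOver-zero p
sumOver-zero (outside ∷ p) = sumOver-zero p

sumOver-distrib-+ : ∀ {n} (p : Subset n) (g h : Fin n → ℕ) → ∑[ x ∈ p ] (g x + h x) ≡ ∑[ x ∈ p ] g x + ∑[ x ∈ p ] h x
sumOver-distrib-+ []            g h = refl
sumOver-distrib-+ (inside ∷ p)  g h = begin
  g zero + h zero + ∑[ x ∈ p ] (g (suc x) + h (suc x))               ≡⟨ cong (g zero + h zero +_) (sumOver-distrib-+ p (g ∘ suc) (h ∘ suc)) ⟩
  g zero + h zero + (∑[ x ∈ p ] g (suc x) + ∑[ x ∈ p ] h (suc x))   ≡⟨ interchange (g zero) (h zero) _ _ ⟩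
  g zero + ∑[ x ∈ p ] g (suc x) + (h zero + ∑[ x ∈ p ] h (suc x))   ∎
  where open ≡-Reasoning
sumOver-distrib-+ (outside ∷ p) g h = sumOver-distrib-+ p (g ∘ suc) (h ∘ suc)

sumOver-≤ : ∀ {n} (p : Subset n) {g : Fin n → ℕ} {c} → (∀ x → g x ≤ c) → ∑[ x ∈ p ] g x ≤ ∣ p ∣ * c
sumOver-≤ []            g≤c = z≤n
sumOver-≤ (inside ∷ p)  g≤c = +-mono-≤ (g≤c zero) (sumOver-≤ p (g≤c ∘ suc))
sumOver-≤ (outside ∷ p) g≤c = sumOver-≤ p (g≤c ∘ suc)

frequency : ∀ {n} → List (Subset n) → Fin n → ℕ
frequency ps x = length (filter (x ∈?_) ps)

frequency-++ : ∀ {n} (ps qs : List (Subset n)) x → frequency (ps ++ qs) x ≡ frequency ps x + frequency qs x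
frequency-++ ps qs x = trans (cong length (filter-++ (x ∈?_) ps qs)) (length-++ (filter (x ∈?_) ps))

frequency-[s∷p] : ∀ {n} s (p : Subset n) x → frequency [ s ∷ p ] (suc x) ≡ frequency [ p ] x
frequency-[s∷p] s p x with does (x ∈? p)
... | true  = refl
... | false = refl

sumOver-frequency-[q] : ∀ {n} (p q : Subset n) → ∑[ x ∈ p ] frequency [ q ] x ≡ ∣ p ∩ q ∣
sumOver-frequency-[q] []            []            = refl
sumOver-frequency-[q] (inside ∷ p)  (inside ∷ q)  =
  cong suc (trans (sumOver-cong p (frequency-[s∷p] inside q)) (sumOver-frequency-[q] p q))
sumOver-frequency-[q] (inside ∷ p)  (outside ∷ q) =
  trans (sumOver-cong p (frequency-[s∷p] outside q)) (sumOver-frequency-[q] p q)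
sumOver-frequency-[q] (outside ∷ p) (s ∷ q)       =
  trans (sumOver-cong p (frequency-[s∷p] s q)) (sumOver-frequency-[q] p q)

sumOver-frequency : ∀ {n} (p : Subset n) ps → ∑[ x ∈ p ] frequency ps x ≡ sum (map (λ q → ∣ p ∩ q ∣) ps)
sumOver-frequency p []       = sumOver-zero p
sumOver-frequency p (q ∷ ps) = begin
  ∑[ x ∈ p ] frequency (q ∷ ps) x                        ≡⟨ sumOver-cong p (frequency-++ [ q ] ps) ⟩
  ∑[ x ∈ p ] (frequency [ q ] x + frequency ps x)        ≡⟨ sumOver-distrib-+ p (frequency [ q ]) (frequency ps) ⟩
  ∑[ x ∈ p ] frequency [ q ] x + ∑[ x ∈ p ] frequency ps x ≡⟨ cong₂ _+_ (sumOver-frequency-[q] p q) (sumOver-frequency p ps) ⟩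
  ∣ p ∩ q ∣ + sum (map (λ q → ∣ p ∩ q ∣) ps)            ∎
  where open ≡-Reasoning

sum-∣∩∣≤∣p∣*max-frequency : ∀ {n} (p : Subset n) ps {c} → (∀ x → frequency ps x ≤ c) →
  sum (map (λ q → ∣ p ∩ q ∣) ps) ≤ ∣ p ∣ * c
sum-∣∩∣≤∣p∣*max-frequency p ps ≤c = subst (_≤ _) (sumOver-frequency p ps) (sumOver-≤ p ≤c)

module _ {n} (F : Family n) where

  disjoint-members≤freq : UnionClosed F → ∀ {a x} → a ∈ members F → x ∈ₛ a →
    length (zeros (λ b → ∣ a ∩ b ∣) (members F)) ≤ freq F x
  disjoint-members≤freq closed {a} {x} a∈F x∈a =
    injection⇒length≤ (_∪ a) (Unique.filter⁺ (λ b → meet b ≟ 0) (distinct F)) maps injective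
    where
    meet : Subset n → ℕ
    meet b = ∣ a ∩ b ∣
    maps : ∀ {b} → b ∈ zeros meet (members F) → b ∪ a ∈ filter (x ∈?_) (members F)
    maps b∈ = ∈-filter⁺ (x ∈?_) (closed _ _ (proj₁ (∈-zeros⁻ meet (members F) b∈)) a∈F) (x∈p∪q⁺ (inj₂ x∈a))
    injective : ∀ {b c} → b ∈ zeros meet (members F) → c ∈ zeros meet (members F) → b ∪ a ≡ c ∪ a → b ≡ c
    injective b∈ c∈ = ∪-cancelʳ-disjoint (∣p∣≡0⇒Empty (proj₂ (∈-zeros⁻ meet (members F) b∈)))
                                         (∣p∣≡0⇒Empty (proj₂ (∈-zeros⁻ meet (members F) c∈)))

  empty-members≤1 : length (zeros ∣_∣ (members F)) ≤ 1
  empty-members≤1 = injection⇒length≤ {ys = [ ⊥ ]} (λ b → b) (Unique.filter⁺ (λ b → ∣ b ∣ ≟ 0) (distinct F))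
    (λ b∈ → here (Empty-unique (∣p∣≡0⇒Empty (proj₂ (∈-zeros⁻ ∣_∣ (members F) b∈)))))
    (λ _ _ b≡c → b≡c)

  card≤∣a∣*f+f : UnionClosed F → ∀ {a x f} → a ∈ members F → x ∈ₛ a → (∀ y → freq F y ≤ f) →
    card F ≤ ∣ a ∣ * f + f
  card≤∣a∣*f+f closed {a} {x} {f} a∈F x∈a ≤f = begin
    card F                                                       ≤⟨ length≤sum+zeros meet (members F) ⟩
    sum (map meet (members F)) + length (zeros meet (members F)) ≤⟨ +-mono-≤ meet-bound disjoint-bound ⟩
    ∣ a ∣ * f + f                                                ∎
    where
    open ≤-Reasoning
    meet : Subset n → ℕ
    meet b = ∣ a ∩ b ∣
    meet-bound : sum (map meet (members F)) ≤ ∣ a ∣ * f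
    meet-bound = sum-∣∩∣≤∣p∣*max-frequency a (members F) ≤f
    disjoint-bound : length (zeros meet (members F)) ≤ f
    disjoint-bound = ≤-trans (disjoint-members≤freq closed a∈F x∈a) (≤f x)

  card*∣a∣≤n*f+∣a∣ : ∀ {a : Subset n} {f} → (∀ {b} → b ∈ members F → ∣ b ∣ ≢ 0 → ∣ a ∣ ≤ ∣ b ∣) →
    (∀ y → freq F y ≤ f) → card F * ∣ a ∣ ≤ n * f + ∣ a ∣
  card*∣a∣≤n*f+∣a∣ {a} {f} minimal ≤f = begin
    card F * ∣ a ∣                                                     ≤⟨ length*≤sum+zeros ∣_∣ (All.tabulate minimal) ⟩
    sum (map ∣_∣ (members F)) + length (zeros ∣_∣ (members F)) * ∣ a ∣ ≤⟨ +-mono-≤ sum≤n*f (*-monoˡ-≤ ∣ a ∣ empty-members≤1) ⟩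
    n * f + 1 * ∣ a ∣                                                  ≡⟨ cong (n * f +_) (*-identityˡ ∣ a ∣) ⟩
    n * f + ∣ a ∣                                                      ∎
    where
    open ≤-Reasoning
    sum≤n*f : sum (map ∣_∣ (members F)) ≤ n * f
    sum≤n*f = begin
      sum (map ∣_∣ (members F))               ≡⟨ cong sum (map-cong (λ b → cong ∣_∣ (∩-identityˡ b)) (members F)) ⟨
      sum (map (λ b → ∣ ⊤ ∩ b ∣) (members F)) ≤⟨ sum-∣∩∣≤∣p∣*max-frequency ⊤ (members F) ≤f ⟩
      ∣ ⊤ {n} ∣ * f                           ≡⟨ cong (_* f) (∣⊤∣≡n n) ⟩
      n * f                                   ∎

m²≤4nf² : ∀ {n m a f} → 1 ≤ a → a ≤ n → m ≤ a * f + f → m * a ≤ n * f + a → m * m ≤ 4 * n * (f * f)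
m²≤4nf² {m = m} {a} {zero} _ _ m≤a*0+0 _
  with n≤0⇒n≡0 (≤-trans m≤a*0+0 (≤-reflexive (trans (+-identityʳ (a * 0)) (*-zeroʳ a))))
... | refl = z≤n
m²≤4nf² {n} {m} {a} {f@(suc _)} 1≤a a≤n m≤af+f ma≤nf+a = begin
  m * m                   ≤⟨ *-monoˡ-≤ m m≤af+f ⟩
  (a * f + f) * m         ≡⟨ regroup a f m ⟩
  f * (m * a + m)         ≤⟨ *-monoʳ-≤ f (+-mono-≤ ma≤2nf m≤2nf) ⟩
  f * ((t + t) + (t + t)) ≡⟨ collect n f ⟩
  4 * n * (f * f)         ∎
  where
  open ≤-Reasoning
  t : ℕ
  t = n * f
  instance
    n≢0 : NonZero n
    n≢0 = >-nonZero (≤-trans 1≤a a≤n)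
  m≤2nf : m ≤ t + t
  m≤2nf = ≤-trans m≤af+f (+-mono-≤ (*-monoˡ-≤ f a≤n) (m≤n*m f n))
  ma≤2nf : m * a ≤ t + t
  ma≤2nf = ≤-trans ma≤nf+a (+-monoʳ-≤ t (≤-trans a≤n (m≤m*n n f)))
  regroup : ∀ a f m → (a * f + f) * m ≡ f * (m * a + m)
  regroup = solve-∀
  collect : ∀ n f → f * ((n * f + n * f) + (n * f + n * f)) ≡ 4 * n * (f * f)
  collect = solve-∀

∃-frequent-element : ∀ {n} (F : Family n) → UnionClosed F → ∀ {a₀} → a₀ ∈ members F → Nonempty a₀ →
  ∃ λ x → card F * card F ≤ 4 * n * (freq F x * freq F x)
∃-frequent-element {n} F closed a₀∈F (x₀ , x₀∈a₀)
  with ∃-minimal-positive ∣_∣ a₀∈F (λ ∣a₀∣≡0 → ∣p∣≡0⇒Empty ∣a₀∣≡0 (x₀ , x₀∈a₀))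
... | a , a∈F , ∣a∣≢0 , minimal with ∣p∣≢0⇒Nonempty ∣a∣≢0
... | y , y∈a =
  x , m²≤4nf² (n≢0⇒n>0 ∣a∣≢0) (∣p∣≤n a)
        (card≤∣a∣*f+f F closed a∈F y∈a maximal) (card*∣a∣≤n*f+∣a∣ F {a} minimal maximal)
  where
  x : Fin n
  x = argmax (freq F) y (allFin n)
  maximal : ∀ z → freq F z ≤ freq F x
  maximal z = All.lookup (f[xs]≤f[argmax] y (allFin n)) (∈-allFin z)

n≤2^n : ∀ n → n ≤ 2 ^ n
n≤2^n zero    = z≤n
n≤2^n (suc n) = +-mono-≤ (m^n>0 2 n) (≤-trans (n≤2^n n) (m≤m+n (2 ^ n) 0))

n^k≤2^[n*k] : ∀ n k → n ^ k ≤ 2 ^ (n * k)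
n^k≤2^[n*k] n k = ≤-trans (^-monoˡ-≤ k (n≤2^n n)) (≤-reflexive (^-*-assoc 2 n k))

n^m²≤2^[3nf]² : ∀ n m f → m * m ≤ 4 * n * (f * f) → n ^ (m * m) ≤ 2 ^ ((3 * n * f) * (3 * n * f))
n^m²≤2^[3nf]² n m f m²≤4nf² = ≤-trans (n^k≤2^[n*k] n (m * m)) (^-monoʳ-≤ 2 (begin
  n * (m * m)                     ≤⟨ *-monoʳ-≤ n m²≤4nf² ⟩
  n * (4 * n * (f * f))           ≡⟨ square n f ⟩
  4 * ((n * f) * (n * f))         ≤⟨ *-monoˡ-≤ ((n * f) * (n * f)) (m≤m+n 4 5) ⟩
  9 * ((n * f) * (n * f))         ≡⟨ square′ n f ⟩
  (3 * n * f) * (3 * n * f)       ∎))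
  where
  open ≤-Reasoning
  square : ∀ n f → n * (4 * n * (f * f)) ≡ 4 * ((n * f) * (n * f))
  square = solve-∀
  square′ : ∀ n f → 9 * ((n * f) * (n * f)) ≡ (3 * n * f) * (3 * n * f)
  square′ = solve-∀

-- The paper's bound f ≥ √(log₂ n) m / 3n is encoded as n ^ (m²) ≤ 2 ^ ((3nf)²). The stronger
-- f ≥ m / 2√n proved above implies it for every n.
theorem3p14 : (n : ℕ) → 2 ≤ n → (F : Family n) → Nontrivial F → UnionClosed F →
    2 ^ (7 * n) ≤ n ^ card F →
    ∃ λ (x : Fin n) → n ^ (card F * card F) ≤ 2 ^ ((3 * n * freq F x) * (3 * n * freq F x))
theorem3p14 n@(suc _) (s≤s _) F nontrivial closed _ =
  let a , a∈F , 0∈a = nontrivial zero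
      x , m²≤4nf² = ∃-frequent-element F closed a∈F (zero , 0∈a)
  in x , n^m²≤2^[3nf]² n (card F) (freq F x) m²≤4nf²
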